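{- Let $\mathcal F=\bigwedge_{i=1}^{m}\bigvee_{j=1}^{j_i}\ell_{i,j}$ be a positive $k$-CNF formula over variables $X_1,\dots,X_n$ (each literal $\ell_{i,j}$ is some variable $X_u$, and $j_i\le k$). Consider: (L) the linear system $\sum_{j\le j_i}\ell_{i,j}=1$, $1\le i\le m$; (Q) the quadratic system consisting of the equations $$\Big(\sum_{j\le j_i}\ell_{i,j}\Big)\cdot\Big(\sum_{j\le j_t}\ell_{t,j}\Big)=1,\quad 1\le i\le t\le m,$$ $$X_u\cdot\sum_{j\le j_i}\ell_{i,j}=X_u^2,\quad 1\le u\le n,\ 1\le i\le m;$$ (R) the linear system $ReL(Z)$ obtained from (Q) by expanding the products and replacing each quadratic monomial $X_iX_j$ (with $X_iX_j$ and $X_jX_i$ identified, $i\le j$) by a new unknown $Z_{ij}$. Then the following are equivalent: (1) (L) has a Boolean solution; (2) (Q) has a Boolean solution; (3) $ReL(Z)$ has a Boolean solution.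
   Context: A Boolean solution of a system of equations is a solution in which every unknown takes a value in $\{0,1\}$. In the systems above, each literal $\ell_{i,j}=X_u$ is read as the real unknown $X_u$. -}

module Defs where

open import Data.Nat using (ℕ; zero; suc; _+_; _*_; _≤_)
open import Data.Bool using (Bool; true; false; if_then_else_)
open import Data.Fin using (Fin; toℕ)
open import Data.Fin as F using ()
open import Data.Nat using (_≤ᵇ_)
open import Data.List using (List; length; map)
open import Data.Nat.ListAction using (sum)
open import Data.Product using (_×_; ∃)
open import Relation.Binary.PropositionalEquality using (_≡_)

-- Boolean value read as the number 0 or 1 (the real unknowns restricted to {0,1};
-- all equations then have natural-number values, so equality in ℝ coincides with
-- equality in ℕ).
b2n : Bool → ℕ
b2n true  = 1
b2n false = 0

Clause : ℕ → Set
Clause n = List (Fin n)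

CNF : ℕ → ℕ → Set
CNF n m = Fin m → Clause n

IsKCNF : ∀ {n m} → ℕ → CNF n m → Set
IsKCNF k F = ∀ i → length (F i) ≤ k

clauseSum : ∀ {n} → (Fin n → Bool) → Clause n → ℕ
clauseSum X C = sum (map (λ u → b2n (X u)) C)

SolL : ∀ {n m} → CNF n m → (Fin n → Bool) → Set
SolL F X = ∀ i → clauseSum X (F i) ≡ 1

SolQ : ∀ {n m} → CNF n m → (Fin n → Bool) → Set
SolQ F X =
  (∀ i t → i F.≤ t → clauseSum X (F i) * clauseSum X (F t) ≡ 1)
  × (∀ u i → b2n (X u) * clauseSum X (F i) ≡ b2n (X u) * b2n (X u))

-- The unknown Z_{ab} with a ≤ b; the monomials X_a X_b and X_b X_a are identified,
-- so the pair is ordered before looking up Z (only entries Z a b with a ≤ b are used).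
Zmon : ∀ {n} → (Fin n → Fin n → Bool) → Fin n → Fin n → ℕ
Zmon Z a b = b2n (if toℕ a ≤ᵇ toℕ b then Z a b else Z b a)

-- (R) = ReL(Z): expand the products of (Q) and replace each X_a X_b by Z_{min,max}
--   Σ_{a ∈ C_i} Σ_{b ∈ C_t} Z_{ab} = 1   (i ≤ t)
--   Σ_{b ∈ C_i} Z_{ub} = Z_{uu}
SolR : ∀ {n m} → CNF n m → (Fin n → Fin n → Bool) → Set
SolR F Z =
  (∀ i t → i F.≤ t →
     sum (map (λ a → sum (map (λ b → Zmon Z a b) (F t))) (F i)) ≡ 1)
  × (∀ u i → sum (map (λ b → Zmon Z u b) (F i)) ≡ Zmon Z u u)

-- On Boolean values x² = x, so every equation of (Q) holds for X exactly when the
-- corresponding equation of ReL(Z) holds for Z_ab = X_a X_b; in particular (Q) is solved by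
-- a solution of (L).  Conversely, the diagonal equations (i = t) force each clause sum to 1,
-- and in ReL(Z) summing Σ_{b∈C_i} Z_ab = Z_aa over a ∈ C_i turns the diagonal equation
-- into Σ_{a∈C_i} Z_aa = 1, so the diagonal of Z solves (L).
module Submission where

open import Defs
open import Data.Nat using (ℕ; _+_; _*_; _≤ᵇ_)
open import Data.Nat.Properties using (*-comm; *-distribˡ-+; *-distribʳ-+; *-zeroʳ; *-identityˡ; *-identityʳ; m*n≡1⇒n≡1)
open import Data.Nat.ListAction using (sum)
open import Data.Bool using (Bool; true; false; _∧_)
open import Data.Fin using (Fin; toℕ)
open import Data.Fin.Properties using (≤-refl)
open import Data.List using ([]; _∷_; map)
open import Data.List.Properties using (map-cong)
open import Data.Product using (∃; _×_; _,_)
open import Function.Bundles using (_⇔_; mk⇔)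
open import Relation.Binary.PropositionalEquality
  using (_≡_; _≗_; refl; sym; trans; cong; cong₂; module ≡-Reasoning)

open ≡-Reasoning

sum-map-cong : ∀ {A : Set} {f g : A → ℕ} → f ≗ g → ∀ xs → sum (map f xs) ≡ sum (map g xs)
sum-map-cong f≗g xs = cong sum (map-cong f≗g xs)

sum-map-*ˡ : ∀ {A : Set} c (f : A → ℕ) xs → sum (map (λ x → c * f x) xs) ≡ c * sum (map f xs)
sum-map-*ˡ c f []       = sym (*-zeroʳ c)
sum-map-*ˡ c f (x ∷ xs) = begin
  c * f x + sum (map (λ x → c * f x) xs) ≡⟨ cong (c * f x +_) (sum-map-*ˡ c f xs) ⟩
  c * f x + c * sum (map f xs)           ≡⟨ *-distribˡ-+ c (f x) _ ⟨
  c * sum (map f (x ∷ xs))               ∎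

sum-map-*ʳ : ∀ {A : Set} c (f : A → ℕ) xs → sum (map (λ x → f x * c) xs) ≡ sum (map f xs) * c
sum-map-*ʳ c f []       = refl
sum-map-*ʳ c f (x ∷ xs) = begin
  f x * c + sum (map (λ x → f x * c) xs) ≡⟨ cong (f x * c +_) (sum-map-*ʳ c f xs) ⟩
  f x * c + sum (map f xs) * c           ≡⟨ *-distribʳ-+ c (f x) _ ⟨
  sum (map f (x ∷ xs)) * c               ∎

b2n-∧ : ∀ x y → b2n (x ∧ y) ≡ b2n x * b2n y
b2n-∧ true  y = sym (*-identityˡ (b2n y))
b2n-∧ false y = refl

b2n-idem : ∀ x → b2n x * b2n x ≡ b2n x
b2n-idem true  = refl
b2n-idem false = refl

outer : ∀ {n} → (Fin n → Bool) → Fin n → Fin n → Bool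
outer X a b = X a ∧ X b

diagonal : ∀ {n} → (Fin n → Fin n → Bool) → Fin n → Bool
diagonal Z u = Z u u

Zmon-outer : ∀ {n} (X : Fin n → Bool) a b → Zmon (outer X) a b ≡ b2n (X a) * b2n (X b)
Zmon-outer X a b with toℕ a ≤ᵇ toℕ b
... | true  = b2n-∧ (X a) (X b)
... | false = trans (b2n-∧ (X b) (X a)) (*-comm (b2n (X b)) (b2n (X a)))

Zmon-diagonal : ∀ {n} (Z : Fin n → Fin n → Bool) u → Zmon Z u u ≡ b2n (diagonal Z u)
Zmon-diagonal Z u with toℕ u ≤ᵇ toℕ u
... | true  = refl
... | false = refl

row-outer : ∀ {n} (X : Fin n → Bool) a (C : Clause n) →
  sum (map (Zmon (outer X) a) C) ≡ b2n (X a) * clauseSum X C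
row-outer X a C = trans (sum-map-cong (Zmon-outer X a) C) (sum-map-*ˡ (b2n (X a)) (λ b → b2n (X b)) C)

block-outer : ∀ {n} (X : Fin n → Bool) (C D : Clause n) →
  sum (map (λ a → sum (map (Zmon (outer X) a) D)) C) ≡ clauseSum X C * clauseSum X D
block-outer X C D = trans (sum-map-cong (λ a → row-outer X a D) C) (sum-map-*ʳ (clauseSum X D) (λ a → b2n (X a)) C)

module _ {n m : ℕ} (F : CNF n m) where

  SolL⇒SolQ : ∀ X → SolL F X → SolQ F X
  SolL⇒SolQ X sol = (λ i t _ → cong₂ _*_ (sol i) (sol t)) , linear
    where
    linear : ∀ u i → b2n (X u) * clauseSum X (F i) ≡ b2n (X u) * b2n (X u)
    linear u i = begin
      b2n (X u) * clauseSum X (F i) ≡⟨ cong (b2n (X u) *_) (sol i) ⟩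
      b2n (X u) * 1                 ≡⟨ *-identityʳ (b2n (X u)) ⟩
      b2n (X u)                     ≡⟨ b2n-idem (X u) ⟨
      b2n (X u) * b2n (X u)         ∎

  SolQ⇒SolL : ∀ X → SolQ F X → SolL F X
  SolQ⇒SolL X (products , _) i = m*n≡1⇒n≡1 (clauseSum X (F i)) _ (products i i ≤-refl)

  SolQ⇒SolR : ∀ X → SolQ F X → SolR F (outer X)
  SolQ⇒SolR X (products , linear) =
    (λ i t i≤t → trans (block-outer X (F i) (F t)) (products i t i≤t)) ,
    (λ u i → begin
      sum (map (Zmon (outer X) u) (F i)) ≡⟨ row-outer X u (F i) ⟩
      b2n (X u) * clauseSum X (F i)      ≡⟨ linear u i ⟩
      b2n (X u) * b2n (X u)              ≡⟨ Zmon-outer X u u ⟨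
      Zmon (outer X) u u                 ∎)

  SolR⇒SolL : ∀ Z → SolR F Z → SolL F (diagonal Z)
  SolR⇒SolL Z (products , linear) i = begin
    clauseSum (diagonal Z) (F i)                       ≡⟨ sum-map-cong (Zmon-diagonal Z) (F i) ⟨
    sum (map (λ a → Zmon Z a a) (F i))                 ≡⟨ sum-map-cong (λ a → linear a i) (F i) ⟨
    sum (map (λ a → sum (map (Zmon Z a) (F i))) (F i)) ≡⟨ products i i ≤-refl ⟩
    1                                                  ∎

theorem1 : ∀ (k n m : ℕ) (F : CNF n m) → IsKCNF k F →
    ((∃ λ (X : Fin n → Bool) → SolL F X) ⇔ (∃ λ (X : Fin n → Bool) → SolQ F X))
    × ((∃ λ (X : Fin n → Bool) → SolQ F X) ⇔ (∃ λ (Z : Fin n → Fin n → Bool) → SolR F Z))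
theorem1 _ n m F _ =
  mk⇔ (λ { (X , sol) → X , SolL⇒SolQ F X sol })
      (λ { (X , sol) → X , SolQ⇒SolL F X sol }) ,
  mk⇔ (λ { (X , sol) → outer X , SolQ⇒SolR F X sol })
      (λ { (Z , sol) → diagonal Z , SolL⇒SolQ F (diagonal Z) (SolR⇒SolL F Z sol) })
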